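{- Let $X,Y$ be topological spaces and $f:X\to Y$ a surjective continuous map. Suppose that $X$ has the local product structure property with respect to $f$ at every point of a dense subset $Z\subseteq X$. Let $B\subseteq Y$ be dense and $A=f^{ -1}(B)$. Then $A$ is dense in $X$.
   Context: Local product structure: for a surjective continuous map $f:X\to Y$ and $x_0\in X$, $y_0=f(x_0)$, $X$ has the local product structure property at $x_0$ with respect to $f$ if there exist a topological space $F_{x_0}$, open sets $O\subseteq X$, $U\subseteq F_{x_0}$, $V\subseteq Y$ with $x_0\in O$, $y_0\in V$, and a homeomorphism $\psi:O\to U\times V$ with $f|_O=\pi_2\circ\psi$, where $\pi_2:U\times V\to V$ is the projection. -}

module Defs where

open import Level using (0ℓ)
open import Data.Product using (Σ; ∃; _×_; _,_; proj₁; proj₂)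
open import Relation.Unary using (Pred; _⊆_; _∈_)
open import Relation.Binary.PropositionalEquality using (_≡_)
open import Data.Unit using (⊤; tt)

record Topology (X : Set) : Set₂ where
  field
    Open    : Pred X 0ℓ → Set₁
    open-univ : Open (λ _ → ⊤)
    open-∩  : ∀ {U V} → Open U → Open V → Open (λ x → U x × V x)
    open-⋃  : (I : Set) (U : I → Pred X 0ℓ) → (∀ i → Open (U i)) →
              Open (λ x → ∃ λ i → U i x)
open Topology public

Continuous : {X Y : Set} → Topology X → Topology Y → (X → Y) → Set₁
Continuous τX τY f = ∀ (V : Pred _ 0ℓ) → Open τY V → Open τX (λ x → V (f x))

Surjective : {X Y : Set} → (X → Y) → Set
Surjective f = ∀ y → ∃ λ x → f x ≡ y

Dense : {X : Set} → Topology X → Pred X 0ℓ → Set₁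
Dense τ D = ∀ (W : Pred _ 0ℓ) → Open τ W → (∃ λ x → W x) → ∃ λ x → W x × D x

Subspace : {X : Set} → Topology X → (S : Pred X 0ℓ) → Topology (Σ X S)
Open (Subspace τ S) W = ∃ λ W' → Open τ W' × (∀ p → (W p → W' (proj₁ p)) × (W' (proj₁ p) → W p))
open-univ (Subspace τ S) = _ , open-univ τ , λ p → (λ x → x) , (λ x → x)
open-∩ (Subspace τ S) (U' , oU , eU) (V' , oV , eV) =
  _ , open-∩ τ oU oV ,
  λ p → (λ { (u , v) → proj₁ (eU p) u , proj₁ (eV p) v })
      , (λ { (u , v) → proj₂ (eU p) u , proj₂ (eV p) v })
open-⋃ (Subspace τ S) I U oU =
  _ , open-⋃ τ I (λ i → proj₁ (oU i)) (λ i → proj₁ (proj₂ (oU i))) ,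
  λ p → (λ { (i , u) → i , proj₁ (proj₂ (proj₂ (oU i)) p) u })
      , (λ { (i , u) → i , proj₂ (proj₂ (proj₂ (oU i)) p) u })

Product : {F Y : Set} → Topology F → Topology Y → Topology (F × Y)
Open (Product τF τY) W =
  ∀ p → W p → ∃ λ U → ∃ λ V → Open τF U × Open τY V ×
    U (proj₁ p) × V (proj₂ p) × (∀ q → U (proj₁ q) → V (proj₂ q) → W q)
open-univ (Product τF τY) p _ = _ , _ , open-univ τF , open-univ τY , _ , _ , λ _ _ _ → _
open-∩ (Product τF τY) oW oW' p (w , w') with oW p w | oW' p w'
... | U , V , oU , oV , u , v , h | U' , V' , oU' , oV' , u' , v' , h' =
  _ , _ , open-∩ τF oU oU' , open-∩ τY oV oV' , (u , u') , (v , v') ,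
  λ q (a , a') (b , b') → h q a b , h' q a' b'
open-⋃ (Product τF τY) I W oW p (i , w) with oW i p w
... | U , V , oU , oV , u , v , h = U , V , oU , oV , u , v , λ q a b → i , h q a b

record Homeomorphism {A B : Set} (τA : Topology A) (τB : Topology B) : Set₁ where
  field
    to       : A → B
    from     : B → A
    from∘to  : ∀ a → from (to a) ≡ a
    to∘from  : ∀ b → to (from b) ≡ b
    to-cont   : Continuous τA τB to
    from-cont : Continuous τB τA from
open Homeomorphism public

-- Local product structure property of X at x₀ with respect to f:
-- there are a space F, open O ⊆ X, U ⊆ F, V ⊆ Y with x₀ ∈ O, f x₀ ∈ V and a
-- homeomorphism ψ : O → U × V (subspace topologies; U × V as a subspace of
-- the product F × Y) with f|_O = π₂ ∘ ψ.
LocalProductStructure : {X Y : Set} → Topology X → Topology Y → (X → Y) → X → Set₂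
LocalProductStructure {X} {Y} τX τY f x₀ =
  Σ Set λ F → Σ (Topology F) λ τF →
  Σ (Pred X 0ℓ) λ O → Σ (Pred F 0ℓ) λ U → Σ (Pred Y 0ℓ) λ V →
  Open τX O × Open τF U × Open τY V × O x₀ × V (f x₀) ×
  Σ (Homeomorphism (Subspace τX O)
       (Subspace (Product τF τY) (λ q → U (proj₁ q) × V (proj₂ q)))) λ ψ →
    ∀ (p : Σ X O) → f (proj₁ p) ≡ proj₂ (proj₁ (to ψ p))

{-# OPTIONS --safe #-}
-- Density is local: it suffices that every neighbourhood of a point of the
-- dense set Z meets f⁻¹(B). Near such a point z a chart ψ identifies X with an
-- open set of F × Y in which f is the second projection. An open
-- neighbourhood of z becomes an open set around ψ z, hence contains a box
-- U₁ × V₁; the open set V₁ ∩ V contains some b ∈ B by density of B, and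
-- ψ⁻¹ (proj₁ (ψ z) , b) is a point of the neighbourhood lying over b.
module Submission where

open import Defs
open import Level using (0ℓ)
open import Relation.Unary using (Pred)
open import Data.Product using (Σ; ∃; _×_; _,_; proj₁; proj₂)
open import Function using (id)
open import Relation.Binary.PropositionalEquality using (_≡_; sym; trans; cong; subst)

Dense-fromLocal : {X : Set} (τ : Topology X) (Z D : Pred X 0ℓ) → Dense τ Z →
  (∀ z → Z z → ∀ W → Open τ W → W z → ∃ λ x → W x × D x) →
  Dense τ D
Dense-fromLocal τ Z D dZ local W oW (_ , Wx) with dZ W oW (_ , Wx)
... | z , Wz , Zz = local z Zz W oW Wz

restrict-open : {X : Set} (τ : Topology X) (S : Pred X 0ℓ) {W : Pred X 0ℓ} →
  Open τ W → Open (Subspace τ S) (λ p → W (proj₁ p))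
restrict-open τ S oW = _ , oW , λ _ → id , id

Box : {F Y : Set} → Pred F 0ℓ → Pred Y 0ℓ → Pred (F × Y) 0ℓ
Box U V q = U (proj₁ q) × V (proj₂ q)

module Chart
  {X Y F : Set} (τX : Topology X) (τY : Topology Y) (τF : Topology F) (f : X → Y)
  {O : Pred X 0ℓ} {U : Pred F 0ℓ} {V : Pred Y 0ℓ} (oV : Open τY V)
  (ψ : Homeomorphism (Subspace τX O) (Subspace (Product τF τY) (Box U V)))
  (f-chart : ∀ (p : Σ X O) → f (proj₁ p) ≡ proj₂ (proj₁ (to ψ p)))
  where

  f∘from : ∀ q → f (proj₁ (from ψ q)) ≡ proj₂ (proj₁ q)
  f∘from q = trans (f-chart (from ψ q)) (cong (λ p → proj₂ (proj₁ p)) (to∘from ψ q))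

  neighbourhood-meets-preimage : (B : Pred Y 0ℓ) → Dense τY B →
    ∀ (p : Σ X O) W → Open τX W → W (proj₁ p) → ∃ λ x → W x × B (f x)
  neighbourhood-meets-preimage B dB p W oW Wp
    with from-cont ψ _ (restrict-open τX O oW)
  ... | W′ , oW′ , W′↔W
    with oW′ (proj₁ (to ψ p)) (proj₁ (W′↔W (to ψ p)) W-from-to-p)
    where
    W-from-to-p : W (proj₁ (from ψ (to ψ p)))
    W-from-to-p = subst (λ p → W (proj₁ p)) (sym (from∘to ψ p)) Wp
  ... | U₁ , V₁ , _ , oV₁ , u₁ , v₁ , U₁×V₁⊆W′
    with dB _ (open-∩ τY oV₁ oV) (_ , v₁ , proj₂ (proj₂ (to ψ p)))
  ... | b , (b∈V₁ , b∈V) , b∈B = proj₁ (from ψ q) , W-from-q , f-from-q∈B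
    where
    q : Σ (F × Y) (Box U V)
    q = (proj₁ (proj₁ (to ψ p)) , b) , proj₁ (proj₂ (to ψ p)) , b∈V

    W-from-q : W (proj₁ (from ψ q))
    W-from-q = proj₂ (W′↔W q) (U₁×V₁⊆W′ (proj₁ q) u₁ b∈V₁)

    f-from-q∈B : B (f (proj₁ (from ψ q)))
    f-from-q∈B = subst B (sym (f∘from q)) b∈B

mainTheorem13 : {X Y : Set} (τX : Topology X) (τY : Topology Y) (f : X → Y) →
    Surjective f → Continuous τX τY f →
    (Z : Pred X 0ℓ) → Dense τX Z →
    (∀ z → Z z → LocalProductStructure τX τY f z) →
    (B : Pred Y 0ℓ) → Dense τY B →
    Dense τX (λ x → B (f x))
mainTheorem13 τX τY f _ _ Z dZ lps B dB = Dense-fromLocal τX Z _ dZ local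
  where
  local : ∀ z → Z z → ∀ W → Open τX W → W z → ∃ λ x → W x × B (f x)
  local z Zz with lps z Zz
  ... | _ , τF , _ , _ , _ , _ , _ , oV , Oz , _ , ψ , f-chart =
    Chart.neighbourhood-meets-preimage τX τY τF f oV ψ f-chart B dB (z , Oz)
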